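{- Fix integers $m\geq 2$ and $0\leq c\leq m-1$. For every integer $n\geq 0$, $g_{m,c}(n;q)=f_{m,c}(n;q)$.
   Context: A $c$-hyper $m$-expansion of a positive integer $n$ is a partition of $n$ into powers of $m$ (i.e. parts from $\{1,m,m^2,\dots\}$) in which each power of $m$ appears exactly $j$ times for some $j\in\{0,1,\ldots,m-1,m+c\}$. For such an expansion $x$ of $n$, let $h_{m,c,n}(x)$ be the number of powers of $m$ that appear exactly $m+c$ times in $x$. For $n\geq 1$ let $g_{m,c}(n;q)=\sum_x q^{h_{m,c,n}(x)}$, the sum over all $c$-hyper $m$-expansions $x$ of $n$; set $g_{m,c}(0;q)=1$ and $g_{m,c}(r;q)=0$ for $r<0$. The polynomials $f_{m,c}(d;q)$ are defined by $f_{m,c}(0;q)=1$, $f_{m,c}(d;q)=0$ for $d<0$, and for $n\ge 0$ with $mn+j\ge 1$: $f_{m,c}(mn+j;q)=f_{m,c}(n;q)$ for $j\in\{0,1,\ldots,m-1\}\setminus\{c\}$, and $f_{m,c}(mn+c;q)=f_{m,c}(n;q)+q\,f_{m,c}(n-1;q)$. -}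

module Defs where

open import Data.Nat using (ℕ; zero; suc; _+_; _*_; _∸_; _/_; _%_; _≡ᵇ_; NonZero)
open import Data.Bool using (Bool; true; false; if_then_else_; _∧_)
open import Data.List using (List; []; _∷_; _++_; map; concatMap; upTo; length)

-- Polynomials in q with natural-number coefficients are represented by
-- their coefficient sequence: P k = coefficient of q^k.
Poly : Set
Poly = ℕ → ℕ

one : Poly
one zero    = 1
one (suc _) = 0

zeroP : Poly
zeroP _ = 0

_⊕_ : Poly → Poly → Poly
(P ⊕ Q) k = P k + Q k

shiftQ : Poly → Poly
shiftQ P zero    = 0
shiftQ P (suc k) = P k

-- Structural recursion uses a fuel argument; with fuel
-- ≥ d+1 the value is the paper's f (fuel is never exhausted since
-- n = d / m < d for d ≥ 1).

fFuel : (m : ℕ) → .{{NonZero m}} → ℕ → ℕ → ℕ → Poly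
fFuel m c zero     d       = zeroP
fFuel m c (suc fu) zero    = one
fFuel m c (suc fu) (suc d') with (suc d' % m) ≡ᵇ c
... | false = fFuel m c fu (suc d' / m)
... | true  = fFuel m c fu (suc d' / m) ⊕ shiftQ (prev (suc d' / m))
  where
  -- f(n-1;q), with f(-1;q) = 0
  prev : ℕ → Poly
  prev zero    = zeroP
  prev (suc n) = fFuel m c fu n

f : (m : ℕ) → .{{NonZero m}} → (c d : ℕ) → Poly
f m c d = fFuel m c (suc d) d

-- An expansion of n (a partition of n into powers
-- of m) is recorded by its multiplicity list (a₀, a₁, …, a_{L-1}), where
-- aᵢ is the number of times m^i occurs.  For n ≥ 1 only powers m^i with i ≤ n can occur
-- (m^i > n for i ≥ n when m ≥ 2), so lists of length n+1 enumerate every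
-- expansion of n exactly once.

allowed : ℕ → ℕ → List ℕ
allowed m c = upTo m ++ (m + c ∷ [])

listsOver : ℕ → List ℕ → List (List ℕ)
listsOver zero    D = [] ∷ []
listsOver (suc L) D = concatMap (λ a → map (a ∷_) (listsOver L D)) D

value : ℕ → List ℕ → ℕ
value m []       = 0
value m (a ∷ as) = a + m * value m as

hStat : ℕ → ℕ → List ℕ → ℕ
hStat m c []       = 0
hStat m c (a ∷ as) = (if a ≡ᵇ (m + c) then 1 else 0) + hStat m c as

countBy : {A : Set} → (A → Bool) → List A → ℕ
countBy p []       = 0
countBy p (x ∷ xs) = (if p x then 1 else 0) + countBy p xs

g : (m c n : ℕ) → Poly
g m c zero    = one
g m c (suc n) k =
  countBy (λ x → (value m x ≡ᵇ suc n) ∧ (hStat m c x ≡ᵇ k))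
          (listsOver (suc (suc n)) (allowed m c))

-- Read an expansion of N by its lowest digit a₀ (the multiplicity of m⁰).
-- Either a₀ < m, and then a₀ = N mod m and the remaining digits expand ⌊N/m⌋;
-- or a₀ = m + c, which forces N ≡ c (mod m), contributes one factor q, and the
-- remaining digits expand ⌊N/m⌋ - 1.  Hence the generating polynomials of
-- expansions satisfy the recursion defining f, and the two agree by induction
-- on N.
module Submission where

open import Defs
open import Data.Nat using (ℕ; zero; suc; _+_; _*_; _/_; _%_; _≡ᵇ_; _≤_; _<_; z≤n; s≤s; NonZero)
open import Data.Nat.Properties
open import Data.Nat.DivMod using (m≡m%n+[m/n]*n; [m+kn]%n≡m%n; m<n⇒m%n≡m; m%n<n; 0/n≡0; m/n<m)
open import Data.Bool using (Bool; true; false; if_then_else_; _∧_)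
open import Data.Bool.Properties using (∧-assoc; ∧-zeroʳ)
open import Data.List using (List; []; _∷_; _++_; map; concatMap; applyUpTo; upTo)
open import Data.List.Properties using (map-cong; map-++; map-upTo)
open import Data.Nat.ListAction using (sum)
open import Data.Nat.ListAction.Properties using (sum-++)
open import Data.Product using (_×_; _,_)
open import Function using (_∘_; mk⇔)
open import Relation.Nullary.Decidable using (does-⇔; dec-true; dec-false; _×-dec_)
open import Relation.Binary.PropositionalEquality
open ≡-Reasoning

≡ᵇ-refl : ∀ n → (n ≡ᵇ n) ≡ true
≡ᵇ-refl n = dec-true (n ≟ n) refl

≢⇒≡ᵇ-false : ∀ {m n} → m ≢ n → (m ≡ᵇ n) ≡ false
≢⇒≡ᵇ-false {m} {n} = dec-false (m ≟ n)

private variable A B : Set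

countBy-++ : (p : A → Bool) (xs ys : List A) →
             countBy p (xs ++ ys) ≡ countBy p xs + countBy p ys
countBy-++ p []       ys = refl
countBy-++ p (x ∷ xs) ys =
  trans (cong (_ +_) (countBy-++ p xs ys)) (sym (+-assoc (if p x then 1 else 0) _ _))

countBy-cong : {p q : A → Bool} → p ≗ q → countBy p ≗ countBy q
countBy-cong p≗q []       = refl
countBy-cong p≗q (x ∷ xs) = cong₂ (λ b n → (if b then 1 else 0) + n) (p≗q x) (countBy-cong p≗q xs)

countBy-none : {p : A → Bool} → (∀ x → p x ≡ false) → (xs : List A) → countBy p xs ≡ 0
countBy-none p≡false []       = refl
countBy-none p≡false (x ∷ xs) rewrite p≡false x = countBy-none p≡false xs

countBy-∧ : (b : Bool) (p : A → Bool) (xs : List A) →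
            countBy (λ x → b ∧ p x) xs ≡ (if b then countBy p xs else 0)
countBy-∧ false p xs = countBy-none (λ _ → refl) xs
countBy-∧ true  p xs = refl

countBy-map : (p : B → Bool) (h : A → B) (xs : List A) →
              countBy p (map h xs) ≡ countBy (p ∘ h) xs
countBy-map p h []       = refl
countBy-map p h (x ∷ xs) = cong (_ +_) (countBy-map p h xs)

countBy-concatMap : (p : B → Bool) (h : A → List B) (xs : List A) →
                    countBy p (concatMap h xs) ≡ sum (map (countBy p ∘ h) xs)
countBy-concatMap p h []       = refl
countBy-concatMap p h (x ∷ xs) =
  trans (countBy-++ p (h x) (concatMap h xs)) (cong (_ +_) (countBy-concatMap p h xs))

countBy-listsOver-suc : (p : List ℕ → Bool) (L : ℕ) (D : List ℕ) →
  countBy p (listsOver (suc L) D) ≡ sum (map (λ a → countBy (p ∘ (a ∷_)) (listsOver L D)) D)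
countBy-listsOver-suc p L D =
  trans (countBy-concatMap p (λ a → map (a ∷_) (listsOver L D)) D)
        (cong sum (map-cong (λ a → countBy-map p (a ∷_) (listsOver L D)) D))

sum-applyUpTo-zero : (F : ℕ → ℕ) (n : ℕ) → (∀ i → i < n → F i ≡ 0) → sum (applyUpTo F n) ≡ 0
sum-applyUpTo-zero F zero    F≡0 = refl
sum-applyUpTo-zero F (suc n) F≡0 =
  cong₂ _+_ (F≡0 0 (s≤s z≤n)) (sum-applyUpTo-zero (F ∘ suc) n (λ i i<n → F≡0 (suc i) (s≤s i<n)))

sum-applyUpTo-single : (F : ℕ → ℕ) {n r : ℕ} → r < n → (∀ i → i < n → i ≢ r → F i ≡ 0) →
                       sum (applyUpTo F n) ≡ F r
sum-applyUpTo-single F {suc n} {zero} _ F≡0 =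
  trans (cong (F 0 +_) (sum-applyUpTo-zero (F ∘ suc) n (λ i i<n → F≡0 (suc i) (s≤s i<n) λ ())))
        (+-identityʳ (F 0))
sum-applyUpTo-single F {suc n} {suc r} (s≤s r<n) F≡0 =
  cong₂ _+_ (F≡0 0 (s≤s z≤n) λ ())
            (sum-applyUpTo-single (F ∘ suc) r<n
              (λ i i<n i≢r → F≡0 (suc i) (s≤s i<n) (i≢r ∘ suc-injective)))

previous : (ℕ → Poly) → ℕ → Poly
previous F zero    = zeroP
previous F (suc n) = F n

shiftQ-cong : {P Q : Poly} → P ≗ Q → shiftQ P ≗ shiftQ Q
shiftQ-cong P≗Q zero    = refl
shiftQ-cong P≗Q (suc k) = P≗Q k

previous-cong : {F G : ℕ → Poly} (n : ℕ) → (∀ i → i < n → F i ≗ G i) → previous F n ≗ previous G n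
previous-cong zero    F≗G = λ _ → refl
previous-cong (suc n) F≗G = F≗G n ≤-refl

module _ (m : ℕ) .{{_ : NonZero m}} where

  divMod-decomposition : ∀ N → N % m + m * (N / m) ≡ N
  divMod-decomposition N = trans (cong (N % m +_) (*-comm m (N / m))) (sym (m≡m%n+[m/n]*n N m))

  divMod-unique : ∀ {a v N} → a < m → a + m * v ≡ N → N % m ≡ a × v ≡ N / m
  divMod-unique {a} {v} {N} a<m a+mv≡N = N%m≡a , v≡N/m
    where
    N%m≡a : N % m ≡ a
    N%m≡a = begin
      N % m           ≡⟨ cong (_% m) a+mv≡N ⟨
      (a + m * v) % m ≡⟨ cong (λ t → (a + t) % m) (*-comm m v) ⟩
      (a + v * m) % m ≡⟨ [m+kn]%n≡m%n a v m ⟩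
      a % m           ≡⟨ m<n⇒m%n≡m a<m ⟩
      a               ∎
    v≡N/m : v ≡ N / m
    v≡N/m = *-cancelˡ-≡ v (N / m) m (+-cancelˡ-≡ a _ _ (begin
      a + m * v           ≡⟨ a+mv≡N ⟩
      N                   ≡⟨ divMod-decomposition N ⟨
      N % m + m * (N / m) ≡⟨ cong (λ r → r + m * (N / m)) N%m≡a ⟩
      a + m * (N / m)     ∎))

  digit-≡ᵇ : ∀ {a} v N → a < m → (a + m * v ≡ᵇ N) ≡ (N % m ≡ᵇ a) ∧ (v ≡ᵇ N / m)
  digit-≡ᵇ {a} v N a<m =
    does-⇔ (mk⇔ (divMod-unique a<m) reassemble) (a + m * v ≟ N) ((N % m ≟ a) ×-dec (v ≟ N / m))
    where
    reassemble : N % m ≡ a × v ≡ N / m → a + m * v ≡ N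
    reassemble (N%m≡a , v≡N/m) =
      trans (cong₂ (λ r w → r + m * w) (sym N%m≡a) v≡N/m) (divMod-decomposition N)

module Recurrence (m : ℕ) .{{_ : NonZero m}} (c : ℕ) where

  recurrence : (ℕ → Poly) → ℕ → Poly
  recurrence F N = F (N / m) ⊕ (if N % m ≡ᵇ c then shiftQ (previous F (N / m)) else zeroP)

  recurrence-cong : {F G : ℕ → Poly} (N : ℕ) → (∀ n → n ≤ N / m → F n ≗ G n) →
                    recurrence F N ≗ recurrence G N
  recurrence-cong {F} {G} N F≗G k = cong₂ _+_ (F≗G (N / m) ≤-refl k) (carry (N % m ≡ᵇ c))
    where
    carry : ∀ b → (if b then shiftQ (previous F (N / m)) else zeroP) k
                ≡ (if b then shiftQ (previous G (N / m)) else zeroP) k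
    carry false = refl
    carry true  = shiftQ-cong (previous-cong (N / m) (λ n n<N/m → F≗G n (<⇒≤ n<N/m))) k

  recurrence-zero : (F : ℕ → Poly) → recurrence F 0 ≗ F 0
  recurrence-zero F k = begin
    recurrence F 0 k                                       ≡⟨ cong (λ q → atQuotient q k) (0/n≡0 m) ⟩
    F 0 k + (if 0 % m ≡ᵇ c then shiftQ zeroP else zeroP) k ≡⟨ cong (F 0 k +_) (noCarry (0 % m ≡ᵇ c) k) ⟩
    F 0 k + 0                                              ≡⟨ +-identityʳ _ ⟩
    F 0 k                                                  ∎
    where
    atQuotient : ℕ → Poly
    atQuotient q = F q ⊕ (if 0 % m ≡ᵇ c then shiftQ (previous F q) else zeroP)
    noCarry : ∀ b k → (if b then shiftQ zeroP else zeroP) k ≡ 0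
    noCarry false k       = refl
    noCarry true  zero    = refl
    noCarry true  (suc k) = refl

  fFuel-suc : ∀ fu d → fFuel m c (suc fu) (suc d) ≗ recurrence (fFuel m c fu) (suc d)
  fFuel-suc fu d k with suc d % m ≡ᵇ c
  ... | false = sym (+-identityʳ _)
  -- f's local f(n-1) only computes once the quotient is a constructor.
  ... | true with suc d / m
  ...   | zero  = refl
  ...   | suc n = refl

module Expansions (m : ℕ) .{{_ : NonZero m}} (c : ℕ) (c<m : c < m) where

  open Recurrence m c

  digits : List ℕ
  digits = allowed m c

  isExpansion : ℕ → ℕ → List ℕ → Bool
  isExpansion N k x = (value m x ≡ᵇ N) ∧ (hStat m c x ≡ᵇ k)

  -- g (N; q) restricted to expansions using only the powers m⁰, …, m^(L-1).
  expansions : ℕ → ℕ → Poly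
  expansions L N k = countBy (isExpansion N k) (listsOver L digits)

  isExpansion-smallDigit : ∀ {a} N k x → a < m →
    isExpansion N k (a ∷ x) ≡ (N % m ≡ᵇ a) ∧ isExpansion (N / m) k x
  isExpansion-smallDigit {a} N k x a<m
    rewrite ≢⇒≡ᵇ-false (<⇒≢ (m≤n⇒m≤n+o c a<m)) =
    trans (cong (_∧ (hStat m c x ≡ᵇ k)) (digit-≡ᵇ m (value m x) N a<m))
          (∧-assoc (N % m ≡ᵇ a) _ _)

  isExpansion-hyperDigit : ∀ N k x →
    isExpansion N k ((m + c) ∷ x)
      ≡ (N % m ≡ᵇ c) ∧ ((suc (value m x) ≡ᵇ N / m) ∧ (suc (hStat m c x) ≡ᵇ k))
  isExpansion-hyperDigit N k x rewrite ≡ᵇ-refl (m + c) =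
    trans (cong (λ t → (t ≡ᵇ N) ∧ (suc (hStat m c x) ≡ᵇ k)) hyperDigit-carries)
          (trans (cong (_∧ (suc (hStat m c x) ≡ᵇ k)) (digit-≡ᵇ m (suc (value m x)) N c<m))
                 (∧-assoc (N % m ≡ᵇ c) _ _))
    where
    hyperDigit-carries : m + c + m * value m x ≡ c + m * suc (value m x)
    hyperDigit-carries = begin
      m + c + m * value m x   ≡⟨ cong (_+ m * value m x) (+-comm m c) ⟩
      c + m + m * value m x   ≡⟨ +-assoc c m _ ⟩
      c + (m + m * value m x) ≡⟨ cong (c +_) (*-suc m (value m x)) ⟨
      c + m * suc (value m x) ∎

  leadingDigitCount : ℕ → ℕ → ℕ → ℕ → ℕ
  leadingDigitCount L N k a = countBy (λ x → isExpansion N k (a ∷ x)) (listsOver L digits)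

  smallDigitCount : ∀ L N k {a} → a < m →
    leadingDigitCount L N k a ≡ (if N % m ≡ᵇ a then expansions L (N / m) k else 0)
  smallDigitCount L N k {a} a<m =
    trans (countBy-cong (λ x → isExpansion-smallDigit N k x a<m) (listsOver L digits))
          (countBy-∧ (N % m ≡ᵇ a) (isExpansion (N / m) k) (listsOver L digits))

  smallDigitsCount : ∀ L N k → sum (map (leadingDigitCount L N k) (upTo m)) ≡ expansions L (N / m) k
  smallDigitsCount L N k = begin
    sum (map T (upTo m))     ≡⟨ cong sum (map-upTo T m) ⟩
    sum (applyUpTo T m)      ≡⟨ sum-applyUpTo-single T (m%n<n N m) otherDigit ⟩
    T (N % m)                ≡⟨ smallDigitCount L N k (m%n<n N m) ⟩
    (if N % m ≡ᵇ N % m then expansions L (N / m) k else 0)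
                             ≡⟨ cong (if_then expansions L (N / m) k else 0) (≡ᵇ-refl (N % m)) ⟩
    expansions L (N / m) k   ∎
    where
    T : ℕ → ℕ
    T = leadingDigitCount L N k
    otherDigit : ∀ a → a < m → a ≢ N % m → T a ≡ 0
    otherDigit a a<m a≢N%m =
      trans (smallDigitCount L N k a<m)
            (cong (if_then expansions L (N / m) k else 0) (≢⇒≡ᵇ-false (a≢N%m ∘ sym)))

  shiftedCount : ∀ L M k →
    countBy (λ x → (suc (value m x) ≡ᵇ M) ∧ (suc (hStat m c x) ≡ᵇ k)) (listsOver L digits)
      ≡ shiftQ (previous (expansions L) M) k
  shiftedCount L zero    zero    = countBy-none (λ _ → refl) (listsOver L digits)
  shiftedCount L zero    (suc k) = countBy-none (λ _ → refl) (listsOver L digits)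
  shiftedCount L (suc n) zero    = countBy-none (λ _ → ∧-zeroʳ _) (listsOver L digits)
  shiftedCount L (suc n) (suc k) = refl

  hyperDigitCount : ∀ L N k →
    leadingDigitCount L N k (m + c)
      ≡ (if N % m ≡ᵇ c then shiftQ (previous (expansions L) (N / m)) else zeroP) k
  hyperDigitCount L N k =
    trans (countBy-cong (isExpansion-hyperDigit N k) (listsOver L digits)) (byCarry (N % m ≡ᵇ c))
    where
    byCarry : ∀ b →
      countBy (λ x → b ∧ ((suc (value m x) ≡ᵇ N / m) ∧ (suc (hStat m c x) ≡ᵇ k))) (listsOver L digits)
        ≡ (if b then shiftQ (previous (expansions L) (N / m)) else zeroP) k
    byCarry false = countBy-none (λ _ → refl) (listsOver L digits)
    byCarry true  = shiftedCount L (N / m) k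

  expansions-suc : ∀ L N → expansions (suc L) N ≗ recurrence (expansions L) N
  expansions-suc L N k = begin
    expansions (suc L) N k                          ≡⟨ countBy-listsOver-suc (isExpansion N k) L digits ⟩
    sum (map T (upTo m ++ m + c ∷ []))              ≡⟨ cong sum (map-++ T (upTo m) _) ⟩
    sum (map T (upTo m) ++ T (m + c) ∷ [])          ≡⟨ sum-++ (map T (upTo m)) _ ⟩
    sum (map T (upTo m)) + (T (m + c) + 0)          ≡⟨ cong₂ _+_ (smallDigitsCount L N k) (+-identityʳ _) ⟩
    expansions L (N / m) k + T (m + c)              ≡⟨ cong (expansions L (N / m) k +_) (hyperDigitCount L N k) ⟩
    recurrence (expansions L) N k                   ∎
    where
    T : ℕ → ℕ
    T = leadingDigitCount L N k

  expansions-zero : ∀ L → expansions L 0 ≗ one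
  expansions-zero zero    zero    = refl
  expansions-zero zero    (suc k) = refl
  expansions-zero (suc L) k       = begin
    expansions (suc L) 0 k        ≡⟨ expansions-suc L 0 k ⟩
    recurrence (expansions L) 0 k ≡⟨ recurrence-zero (expansions L) k ⟩
    expansions L 0 k              ≡⟨ expansions-zero L k ⟩
    one k                         ∎

  expansions≗fFuel : 2 ≤ m → ∀ fu L N → N < fu → N < L → expansions L N ≗ fFuel m c fu N
  expansions≗fFuel _   (suc fu) L       zero    _          _          = expansions-zero L
  expansions≗fFuel 2≤m (suc fu) (suc L) (suc d) (s≤s d<fu) (s≤s d<L) k = begin
    expansions (suc L) (suc d) k        ≡⟨ expansions-suc L (suc d) k ⟩
    recurrence (expansions L) (suc d) k ≡⟨ recurrence-cong (suc d) IH k ⟩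
    recurrence (fFuel m c fu) (suc d) k ≡⟨ fFuel-suc fu d k ⟨
    fFuel m c (suc fu) (suc d) k        ∎
    where
    IH : ∀ n → n ≤ suc d / m → expansions L n ≗ fFuel m c fu n
    IH n n≤N/m = expansions≗fFuel 2≤m fu L n (≤-trans n<N d<fu) (≤-trans n<N d<L)
      where
      n<N : n < suc d
      n<N = ≤-<-trans n≤N/m (m/n<m (suc d) m 2≤m)

mainTheorem1 : (m : ℕ) → .{{_ : NonZero m}} → 2 ≤ m → (c : ℕ) → c < m →
    (n : ℕ) → (k : ℕ) → g m c n k ≡ f m c n k
mainTheorem1 m 2≤m c c<m zero    k = refl
mainTheorem1 m 2≤m c c<m (suc n)   =
  expansions≗fFuel 2≤m (suc (suc n)) (suc (suc n)) (suc n) ≤-refl ≤-refl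
  where open Expansions m c c<m
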